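{- For all $p,p'\in\mathrm{Sys}$, $\alpha\in\mathrm{Act}$, transducers $e'$ and closed $\varphi\in\mathrm{SHML}_{\mathrm{nf}}$: if $(\![\varphi]\!)[p]\xrightarrow{\alpha}e'[p']$ then $p\xrightarrow{\alpha}p'$ and $e'=(\![\mathrm{after}(\varphi,\alpha)]\!)$.
   Context: Systems: an LTS $\langle \mathrm{Sys}, \mathrm{Act}\cup\{\tau\}, \to\rangle$; $\mu$ ranges over $\mathrm{Act}\cup\{\tau\}$. Symbolic actions $\{\pi,c\}$: patterns $\pi$ with binding data variables, partial matching $\mathrm{mtch}(\pi,\alpha)$ returning a substitution $\sigma$ such that instantiating bound variables of $\pi$ by $\sigma$ gives $\alpha$, boolean condition $c$ with $c\sigma\Downarrow\mathrm{true}$ meaning true under $\sigma$; write $\mathrm{mtch}(\{\pi,c\},\alpha)=\sigma$ when both hold. $\underline{\pi}$ is $\pi$ with binding occurrences made free. $\mathrm{SHML}_{\mathrm{nf}}$: $\varphi::=\mathrm{tt}\mid\mathrm{ff}\mid\bigwedge_{i\in I}[\{\pi_i,c_i\}]\varphi_i\mid X\mid\max X.\varphi$ ($I$ finite), with pairwise disjoint symbolic actions in each conjunction and $X$ free in $\varphi$ in each $\max X.\varphi$. $\mathrm{after}$: $\mathrm{after}(\varphi,\tau)=\varphi$; $\mathrm{after}(\varphi,\alpha)=\varphi$ for $\varphi\in\{\mathrm{tt},\mathrm{ff}\}$; $\mathrm{after}(\max X.\varphi,\alpha)=\mathrm{after}(\varphi[\max X.\varphi/X],\alpha)$; $\mathrm{after}(\bigwedge_{i}[\{\pi_i,c_i\}]\varphi_i,\alpha)=\varphi_j\sigma$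 if $\mathrm{mtch}(\{\pi_j,c_j\},\alpha)=\sigma$ for some $j$, else $\mathrm{tt}$. Transducers: $e::=\mathrm{id}\mid\{\pi,c,\pi'\}.e\mid\sum_{i\in I}e_i\mid\mathrm{rec}\,x.e\mid x$; transitions $\mathrm{id}\xrightarrow{\mu\triangleright\mu}\mathrm{id}$; $\{\pi,c,\pi'\}.e\xrightarrow{\gamma\triangleright\pi'\sigma}e\sigma$ if $\mathrm{mtch}(\pi,\gamma)=\sigma$, $c\sigma\Downarrow\mathrm{true}$ ($\gamma\in\mathrm{Act}\cup\{\bullet\}$); sums choose a summand; $\mathrm{rec}\,x.e$ behaves as $e[\mathrm{rec}\,x.e/x]$. Monitored system $e[p]$: (iTrn) $p\xrightarrow{\alpha}p'$, $e\xrightarrow{\alpha\triangleright\mu}e'$ give $e[p]\xrightarrow{\mu}e'[p']$; (iAsy) $p\xrightarrow{\tau}p'$ gives $e[p]\xrightarrow{\tau}e[p']$; (iIns) $e\xrightarrow{\bullet\triangleright\mu}e'$ gives $e[p]\xrightarrow{\mu}e'[p]$; (iTer) if $p\xrightarrow{\alpha}p'$ and $e$ has no transition labelled $\alpha\triangleright\mu$ or $\bullet\triangleright\mu$, then $e[p]\xrightarrow{\alpha}\mathrm{id}[p']$. Synthesis: $(\![X]\!)=x_X$; $(\![\mathrm{tt}]\!)=(\![\mathrm{ff}]\!)=\mathrm{id}$; $(\![\max X.\varphi]\!)=\mathrm{rec}\,x_X.(\![\varphi]\!)$; $(\![\bigwedge_{i\in I}[\{\pi_i,c_i\}]\varphi_i]\!)=\mathrm{rec}\,y.\sum_i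 e_i$ ($y$ fresh), $e_i=\{\pi_i,c_i,\tau\}.y$ if $\varphi_i=\mathrm{ff}$, else $\{\pi_i,c_i,\underline{\pi_i}\}.(\![\varphi_i]\!)$. -}

module Defs where

open import Data.Nat using (ℕ; _≟_)
open import Data.Bool using (Bool; true; false)
open import Data.Maybe using (Maybe; just; nothing)
open import Data.Product using (_×_; _,_; ∃)
open import Data.Empty using (⊥)
open import Data.List using (List; []; _∷_)
open import Data.List.Membership.Propositional using (_∈_)
open import Data.List.Relation.Unary.All using (All)
open import Data.List.Relation.Unary.Any using (Any)
open import Data.List.Relation.Unary.AllPairs using (AllPairs)
open import Relation.Nullary using (¬_; yes; no; Dec)
open import Relation.Binary.PropositionalEquality using (_≡_; _≢_; refl)

record Setting : Set₁ where
  field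
    Act   : Set
    Pat   : Set                     -- patterns π (may contain binding and free data variables)
    Cond  : Set
    Sub   : Set
    emp   : Sub
    mtch  : Pat → Act → Maybe Sub
    evalC : Cond → Bool
    substP : Sub → Pat → Pat        -- π σ  (instantiates the free data variables of π)
    substC : Sub → Cond → Cond
    _∖_   : Sub → Pat → Sub         -- σ with the binding variables of π removed (shadowing)
    under : Pat → Pat               -- π̲ : binding occurrences of π made free
    toAct : Pat → Maybe Act         -- a fully instantiated pattern denotes an action
    -- standing assumption of the paper: instantiating the bound
    -- variables of π by σ = mtch(π,α) gives α
    mtch-inst : ∀ π α σ → mtch π α ≡ just σ → toAct (substP σ (under π)) ≡ just α
    -- syntactic fact about patterns: binders are not free occurrences,
    -- so substitution commutes with making binders free
    under-subst : ∀ σ π → under (substP σ π) ≡ substP (σ ∖ π) (under π)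

data Actτ (A : Set) : Set where
  ⟨_⟩ : A → Actτ A
  τ   : Actτ A

record LTS (A : Set) : Set₁ where
  field
    Sys    : Set
    _—_↦_  : Sys → Actτ A → Sys → Set

module Theory (S : Setting) (L : LTS (Setting.Act S)) where
  open Setting S
  open LTS L

  MtchS : Pat → Cond → Act → Sub → Set
  MtchS π c α σ = (mtch π α ≡ just σ) × (evalC (substC σ c) ≡ true)

  data Form : Set
  data Branch : Set

  data Form where
    tt ff : Form
    ⋀     : List Branch → Form
    var   : ℕ → Form
    max   : ℕ → Form → Form

  data Branch where
    [_,_]_ : Pat → Cond → Form → Branch

  body : Branch → Form
  body ([ _ , _ ] φ) = φ

  rsubF  : Form → ℕ → Form → Form
  rsubBs : List Branch → ℕ → Form → List Branch
  rsubF tt X ψ = tt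
  rsubF ff X ψ = ff
  rsubF (⋀ bs) X ψ = ⋀ (rsubBs bs X ψ)
  rsubF (var Y) X ψ with X ≟ Y
  ... | yes _ = ψ
  ... | no  _ = var Y
  rsubF (max Y φ) X ψ with X ≟ Y
  ... | yes _ = max Y φ
  ... | no  _ = max Y (rsubF φ X ψ)
  rsubBs [] X ψ = []
  rsubBs (([ π , c ] φ) ∷ bs) X ψ = ([ π , c ] rsubF φ X ψ) ∷ rsubBs bs X ψ

  substF  : Sub → Form → Form
  substBs : Sub → List Branch → List Branch
  substF σ tt = tt
  substF σ ff = ff
  substF σ (⋀ bs) = ⋀ (substBs σ bs)
  substF σ (var X) = var X
  substF σ (max X φ) = max X (substF σ φ)
  substBs σ [] = []
  substBs σ (([ π , c ] φ) ∷ bs) =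
    ([ substP σ π , substC (σ ∖ π) c ] substF (σ ∖ π) φ) ∷ substBs σ bs

  data FreeIn (X : ℕ) : Form → Set where
    fVar : FreeIn X (var X)
    fMax : ∀ {Y φ} → X ≢ Y → FreeIn X φ → FreeIn X (max Y φ)
    fAnd : ∀ {bs} → Any (λ b → FreeIn X (body b)) bs → FreeIn X (⋀ bs)

  Closed : Form → Set
  Closed φ = ∀ X → ¬ FreeIn X φ

  Disjoint : Branch → Branch → Set
  Disjoint ([ π , c ] _) ([ π' , c' ] _) =
    ∀ α σ σ' → MtchS π c α σ → MtchS π' c' α σ' → ⊥

  data NF : Form → Set where
    nTt  : NF tt
    nFf  : NF ff
    nVar : ∀ {X} → NF (var X)
    nMax : ∀ {X φ} → FreeIn X φ → NF φ → NF (max X φ)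
    nAnd : ∀ {bs} → AllPairs Disjoint bs → All (λ b → NF (body b)) bs → NF (⋀ bs)

  -- after(φ, μ), as the relation given by its defining equations
  data After : Form → Actτ Act → Form → Set where
    aτ    : ∀ {φ} → After φ τ φ
    aTt   : ∀ {α} → After tt ⟨ α ⟩ tt
    aFf   : ∀ {α} → After ff ⟨ α ⟩ ff
    aMax  : ∀ {X φ α ψ} → After (rsubF φ X (max X φ)) ⟨ α ⟩ ψ → After (max X φ) ⟨ α ⟩ ψ
    aHit  : ∀ {bs π c φ α σ} → ([ π , c ] φ) ∈ bs → MtchS π c α σ →
            After (⋀ bs) ⟨ α ⟩ (substF σ φ)
    aMiss : ∀ {bs α} →
            (∀ {π c φ σ} → ([ π , c ] φ) ∈ bs → ¬ MtchS π c α σ) →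
            After (⋀ bs) ⟨ α ⟩ tt

  data TVar : Set where
    xv : ℕ → TVar
    yv : TVar          -- the variable y used by synthesis for conjunctions

  _≟T_ : (a b : TVar) → Dec (a ≡ b)
  xv m ≟T xv n with m ≟ n
  ... | yes refl = yes refl
  ... | no m≢n = no (λ { refl → m≢n refl })
  xv _ ≟T yv = no (λ ())
  yv ≟T xv _ = no (λ ())
  yv ≟T yv = yes refl

  data InPat : Set where
    ipat   : Pat → InPat
    bullet : InPat

  data OutPat : Set where
    opat : Pat → OutPat
    oτ   : OutPat

  data Trans : Set where
    id     : Trans
    ⟪_,_,_⟫∙_ : InPat → Cond → OutPat → Trans → Trans
    sum    : List Trans → Trans
    rec    : TVar → Trans → Trans
    tvar   : TVar → Trans

  data InL : Set where
    inA : Act → InL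
    inτ : InL
    in• : InL

  mtchI : InPat → InL → Maybe Sub
  mtchI (ipat π) (inA α) = mtch π α
  mtchI (ipat π) inτ = nothing
  mtchI (ipat π) in• = nothing
  mtchI bullet (inA _) = nothing
  mtchI bullet inτ = nothing
  mtchI bullet in• = just emp

  outI : OutPat → Sub → Maybe (Actτ Act)
  outI oτ σ = just τ
  outI (opat π) σ with toAct (substP σ π)
  ... | just β  = just ⟨ β ⟩
  ... | nothing = nothing

  _∖ᵢ_ : Sub → InPat → Sub
  σ ∖ᵢ ipat π = σ ∖ π
  σ ∖ᵢ bullet = σ

  substIn : Sub → InPat → InPat
  substIn σ (ipat π) = ipat (substP σ π)
  substIn σ bullet = bullet

  substOut : Sub → OutPat → OutPat
  substOut σ (opat π) = opat (substP σ π)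
  substOut σ oτ = oτ

  substT  : Sub → Trans → Trans
  substTs : Sub → List Trans → List Trans
  substT σ id = id
  substT σ (⟪ ρ , c , π' ⟫∙ e) =
    ⟪ substIn σ ρ , substC (σ ∖ᵢ ρ) c , substOut (σ ∖ᵢ ρ) π' ⟫∙ substT (σ ∖ᵢ ρ) e
  substT σ (sum es) = sum (substTs σ es)
  substT σ (rec x e) = rec x (substT σ e)
  substT σ (tvar x) = tvar x
  substTs σ [] = []
  substTs σ (e ∷ es) = substT σ e ∷ substTs σ es

  rsubT  : Trans → TVar → Trans → Trans
  rsubTs : List Trans → TVar → Trans → List Trans
  rsubT id x t = id
  rsubT (⟪ ρ , c , π' ⟫∙ e) x t = ⟪ ρ , c , π' ⟫∙ rsubT e x t
  rsubT (sum es) x t = sum (rsubTs es x t)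
  rsubT (rec y e) x t with x ≟T y
  ... | yes _ = rec y e
  ... | no  _ = rec y (rsubT e x t)
  rsubT (tvar y) x t with x ≟T y
  ... | yes _ = t
  ... | no  _ = tvar y
  rsubTs [] x t = []
  rsubTs (e ∷ es) x t = rsubT e x t ∷ rsubTs es x t

  data _—_▷_⟶_ : Trans → InL → Actτ Act → Trans → Set where
    tIdA : ∀ {α} → id — inA α ▷ ⟨ α ⟩ ⟶ id
    tIdτ : id — inτ ▷ τ ⟶ id
    tPre : ∀ {ρ c π' e γ σ μ} →
           mtchI ρ γ ≡ just σ → evalC (substC σ c) ≡ true → outI π' σ ≡ just μ →
           (⟪ ρ , c , π' ⟫∙ e) — γ ▷ μ ⟶ substT σ e
    tSum : ∀ {es e γ μ e'} → e ∈ es → e — γ ▷ μ ⟶ e' → sum es — γ ▷ μ ⟶ e'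
    tRec : ∀ {x e γ μ e'} → rsubT e x (rec x e) — γ ▷ μ ⟶ e' → rec x e — γ ▷ μ ⟶ e'

  data MSys : Set where
    _[_] : Trans → Sys → MSys

  data _⟹_⟹_ : MSys → Actτ Act → MSys → Set where
    iTrn : ∀ {e e' p p' α μ} → p — ⟨ α ⟩ ↦ p' → e — inA α ▷ μ ⟶ e' →
           (e [ p ]) ⟹ μ ⟹ (e' [ p' ])
    iAsy : ∀ {e p p'} → p — τ ↦ p' → (e [ p ]) ⟹ τ ⟹ (e [ p' ])
    iIns : ∀ {e e' p μ} → e — in• ▷ μ ⟶ e' → (e [ p ]) ⟹ μ ⟹ (e' [ p ])
    iTer : ∀ {e p p' α} → p — ⟨ α ⟩ ↦ p' →
           (∀ {μ e'} → ¬ (e — inA α ▷ μ ⟶ e')) →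
           (∀ {μ e'} → ¬ (e — in• ▷ μ ⟶ e')) →
           (e [ p ]) ⟹ ⟨ α ⟩ ⟹ (id [ p' ])

  ⦅_⦆   : Form → Trans
  synBs : List Branch → List Trans
  synB  : Pat → Cond → Form → Trans
  ⦅ tt ⦆ = id
  ⦅ ff ⦆ = id
  ⦅ var X ⦆ = tvar (xv X)
  ⦅ max X φ ⦆ = rec (xv X) ⦅ φ ⦆
  ⦅ ⋀ bs ⦆ = rec yv (sum (synBs bs))
  synBs [] = []
  synBs (([ π , c ] φ) ∷ bs) = synB π c φ ∷ synBs bs
  synB π c ff = ⟪ ipat π , c , oτ ⟫∙ tvar yv
  synB π c tt = ⟪ ipat π , c , opat (under π) ⟫∙ ⦅ tt ⦆
  synB π c (⋀ bs) = ⟪ ipat π , c , opat (under π) ⟫∙ ⦅ ⋀ bs ⦆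
  synB π c (var X) = ⟪ ipat π , c , opat (under π) ⟫∙ ⦅ var X ⦆
  synB π c (max X φ) = ⟪ ipat π , c , opat (under π) ⟫∙ ⦅ max X φ ⦆

module Submission where

-- The proof analyses the three rules that can produce a visible step.
--  * (iTrn): by induction on the transducer derivation.  Unfolding
--    ⦅max X.φ⦆ yields ⦅φ[max X.φ/X]⦆ (synthesis commutes with recursion
--    variable substitution), and a step of ⦅⋀ᵢ[{πᵢ,cᵢ}]φᵢ⦆ fires a single
--    branch; a violation branch (φᵢ = ff) outputs τ, so the branch is a
--    forwarding one, whose output is the input action itself and whose
--    residual is ⦅φᵢ⦆σ = ⦅φᵢσ⦆.  Since the symbolic actions of a
--    conjunction are disjoint, this is exactly the branch chosen by after.
--  * (iIns): synthesised transducers never fire on the input •.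
--  * (iTer): if ⦅φ⦆ cannot react to α, then no branch met along the
--    unfolding of φ matches α, so after(φ, α) is tt or ff and ⦅tt⦆ = ⦅ff⦆ = id.

open import Defs
open import Data.Product using (_×_; _,_; Σ-syntax; proj₁; map₂)
open import Data.Maybe using (just)
open import Data.Maybe.Properties using (just-injective)
open import Data.Empty using (⊥-elim)
open import Data.List using ([]; _∷_)
open import Data.List.Membership.Propositional using (_∈_)
open import Data.List.Relation.Unary.All as All using (All; []; _∷_)
open import Data.List.Relation.Unary.Any using (here; there)
open import Data.List.Relation.Unary.AllPairs using (AllPairs; []; _∷_)
open import Data.Nat using (_≟_)
open import Relation.Nullary using (¬_; Dec; yes; no)
open import Relation.Binary.PropositionalEquality
  using (_≡_; _≢_; refl; sym; trans; cong; cong₂; subst; module ≡-Reasoning)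

module SynthesisProperties (S : Setting) (L : LTS (Setting.Act S)) where
  open Setting S
  open LTS L
  open Theory S L
  open ≡-Reasoning

  data AllDisjoint : Form → Set where
    dTt  : AllDisjoint tt
    dFf  : AllDisjoint ff
    dVar : ∀ {X} → AllDisjoint (var X)
    dMax : ∀ {X φ} → AllDisjoint φ → AllDisjoint (max X φ)
    dAnd : ∀ {bs} → AllPairs Disjoint bs → All (λ b → AllDisjoint (body b)) bs →
           AllDisjoint (⋀ bs)

  NF⇒AllDisjoint  : ∀ {φ} → NF φ → AllDisjoint φ
  NFs⇒AllDisjoint : ∀ {bs} → All (λ b → NF (body b)) bs → All (λ b → AllDisjoint (body b)) bs
  NF⇒AllDisjoint nTt          = dTt
  NF⇒AllDisjoint nFf          = dFf
  NF⇒AllDisjoint nVar         = dVar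
  NF⇒AllDisjoint (nMax _ nf)  = dMax (NF⇒AllDisjoint nf)
  NF⇒AllDisjoint (nAnd ds nfs) = dAnd ds (NFs⇒AllDisjoint nfs)
  NFs⇒AllDisjoint []          = []
  NFs⇒AllDisjoint (nf ∷ nfs)  = NF⇒AllDisjoint nf ∷ NFs⇒AllDisjoint nfs

  -- Recursion-variable substitution only rewrites branch bodies, so the
  -- symbolic actions of every conjunction, and their disjointness, survive.
  rsubBs-pairwise : ∀ bs X ψ → AllPairs Disjoint bs → AllPairs Disjoint (rsubBs bs X ψ)
  rsubBs-pairwise [] X ψ [] = []
  rsubBs-pairwise (([ π , c ] φ) ∷ bs) X ψ (d ∷ ds) = heads bs d ∷ rsubBs-pairwise bs X ψ ds
    where
    heads : ∀ bs' → All (Disjoint ([ π , c ] φ)) bs' →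
            All (Disjoint ([ π , c ] rsubF φ X ψ)) (rsubBs bs' X ψ)
    heads [] [] = []
    heads (([ _ , _ ] _) ∷ bs') (d' ∷ ds') = d' ∷ heads bs' ds'

  AllDisjoint-rsub  : ∀ {φ ψ} X → AllDisjoint φ → AllDisjoint ψ → AllDisjoint (rsubF φ X ψ)
  AllDisjoint-rsubs : ∀ {bs ψ} X → All (λ b → AllDisjoint (body b)) bs → AllDisjoint ψ →
                      All (λ b → AllDisjoint (body b)) (rsubBs bs X ψ)
  AllDisjoint-rsub X dTt dψ = dTt
  AllDisjoint-rsub X dFf dψ = dFf
  AllDisjoint-rsub X (dVar {Y}) dψ with X ≟ Y
  ... | yes _ = dψ
  ... | no _  = dVar
  AllDisjoint-rsub X (dMax {Y} dφ) dψ with X ≟ Y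
  ... | yes _ = dMax dφ
  ... | no _  = dMax (AllDisjoint-rsub X dφ dψ)
  AllDisjoint-rsub {⋀ bs} {ψ} X (dAnd ds dbs) dψ =
    dAnd (rsubBs-pairwise bs X ψ ds) (AllDisjoint-rsubs X dbs dψ)
  AllDisjoint-rsubs X [] dψ = []
  AllDisjoint-rsubs {([ _ , _ ] _) ∷ _} X (d ∷ ds) dψ =
    AllDisjoint-rsub X d dψ ∷ AllDisjoint-rsubs X ds dψ

  ff? : (φ : Form) → Dec (φ ≡ ff)
  ff? tt        = no λ ()
  ff? ff        = yes refl
  ff? (⋀ _)     = no λ ()
  ff? (var _)   = no λ ()
  ff? (max _ _) = no λ ()

  synB-forward : ∀ π c φ → φ ≢ ff → synB π c φ ≡ (⟪ ipat π , c , opat (under π) ⟫∙ ⦅ φ ⦆)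
  synB-forward π c tt        _    = refl
  synB-forward π c ff        φ≢ff = ⊥-elim (φ≢ff refl)
  synB-forward π c (⋀ _)     _    = refl
  synB-forward π c (var _)   _    = refl
  synB-forward π c (max _ _) _    = refl

  rsubF-nonff : ∀ φ X ψ → φ ≢ ff → ψ ≢ ff → rsubF φ X ψ ≢ ff
  rsubF-nonff ff X ψ φ≢ff _ = φ≢ff
  rsubF-nonff tt X ψ _ _ ()
  rsubF-nonff (⋀ _) X ψ _ _ ()
  rsubF-nonff (var Y) X ψ _ ψ≢ff with X ≟ Y
  ... | yes _ = ψ≢ff
  ... | no _  = λ ()
  rsubF-nonff (max Y φ) X ψ _ _ with X ≟ Y
  ... | yes _ = λ ()
  ... | no _  = λ ()

  substF-nonff : ∀ σ φ → φ ≢ ff → substF σ φ ≢ ff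
  substF-nonff σ ff φ≢ff = φ≢ff
  substF-nonff σ tt _ ()
  substF-nonff σ (⋀ _) _ ()
  substF-nonff σ (var _) _ ()
  substF-nonff σ (max _ _) _ ()

  -- Synthesis commutes with recursion-variable substitution:
  -- ⦅φ⦆[⦅ψ⦆/x_X] = ⦅φ[ψ/X]⦆.  (ψ ≢ ff: a violation branch keeps its
  -- special shape only if substitution cannot turn its body into ff.)
  synth-rsub  : ∀ φ X ψ → ψ ≢ ff → rsubT ⦅ φ ⦆ (xv X) ⦅ ψ ⦆ ≡ ⦅ rsubF φ X ψ ⦆
  synth-rsubs : ∀ bs X ψ → ψ ≢ ff → rsubTs (synBs bs) (xv X) ⦅ ψ ⦆ ≡ synBs (rsubBs bs X ψ)
  synth-rsubB : ∀ π c φ X ψ → ψ ≢ ff → rsubT (synB π c φ) (xv X) ⦅ ψ ⦆ ≡ synB π c (rsubF φ X ψ)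
  synth-rsub tt X ψ _ = refl
  synth-rsub ff X ψ _ = refl
  synth-rsub (⋀ bs) X ψ ψ≢ff = cong (λ es → rec yv (sum es)) (synth-rsubs bs X ψ ψ≢ff)
  synth-rsub (var Y) X ψ _ with X ≟ Y
  ... | yes refl = refl
  ... | no _     = refl
  synth-rsub (max Y φ) X ψ ψ≢ff with X ≟ Y
  ... | yes refl = refl
  ... | no _     = cong (rec (xv Y)) (synth-rsub φ X ψ ψ≢ff)
  synth-rsubs [] X ψ _ = refl
  synth-rsubs (([ π , c ] φ) ∷ bs) X ψ ψ≢ff =
    cong₂ _∷_ (synth-rsubB π c φ X ψ ψ≢ff) (synth-rsubs bs X ψ ψ≢ff)
  synth-rsubB π c φ X ψ ψ≢ff with ff? φ
  ... | yes refl = refl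
  ... | no φ≢ff  = begin
    rsubT (synB π c φ) (xv X) ⦅ ψ ⦆
      ≡⟨ cong (λ e → rsubT e (xv X) ⦅ ψ ⦆) (synB-forward π c φ φ≢ff) ⟩
    ⟪ ipat π , c , opat (under π) ⟫∙ rsubT ⦅ φ ⦆ (xv X) ⦅ ψ ⦆
      ≡⟨ cong (⟪ ipat π , c , opat (under π) ⟫∙_) (synth-rsub φ X ψ ψ≢ff) ⟩
    ⟪ ipat π , c , opat (under π) ⟫∙ ⦅ rsubF φ X ψ ⦆
      ≡⟨ sym (synB-forward π c (rsubF φ X ψ) (rsubF-nonff φ X ψ φ≢ff ψ≢ff)) ⟩
    synB π c (rsubF φ X ψ) ∎

  synth-subst  : ∀ σ φ → substT σ ⦅ φ ⦆ ≡ ⦅ substF σ φ ⦆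
  synth-substs : ∀ σ bs → substTs σ (synBs bs) ≡ synBs (substBs σ bs)
  synth-substB : ∀ σ π c φ →
                 substT σ (synB π c φ) ≡ synB (substP σ π) (substC (σ ∖ π) c) (substF (σ ∖ π) φ)
  synth-subst σ tt = refl
  synth-subst σ ff = refl
  synth-subst σ (⋀ bs) = cong (λ es → rec yv (sum es)) (synth-substs σ bs)
  synth-subst σ (var X) = refl
  synth-subst σ (max X φ) = cong (rec (xv X)) (synth-subst σ φ)
  synth-substs σ [] = refl
  synth-substs σ (([ π , c ] φ) ∷ bs) = cong₂ _∷_ (synth-substB σ π c φ) (synth-substs σ bs)
  synth-substB σ π c φ with ff? φ
  ... | yes refl = refl
  ... | no φ≢ff  = begin
    substT σ (synB π c φ)
      ≡⟨ cong (substT σ) (synB-forward π c φ φ≢ff) ⟩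
    ⟪ ipat (substP σ π) , c' , opat (substP (σ ∖ π) (under π)) ⟫∙ substT (σ ∖ π) ⦅ φ ⦆
      ≡⟨ cong₂ (λ π' e → ⟪ ipat (substP σ π) , c' , opat π' ⟫∙ e)
               (sym (under-subst σ π)) (synth-subst (σ ∖ π) φ) ⟩
    ⟪ ipat (substP σ π) , c' , opat (under (substP σ π)) ⟫∙ ⦅ substF (σ ∖ π) φ ⦆
      ≡⟨ sym (synB-forward (substP σ π) c' (substF (σ ∖ π) φ) (substF-nonff (σ ∖ π) φ φ≢ff)) ⟩
    synB (substP σ π) c' (substF (σ ∖ π) φ) ∎
    where c' = substC (σ ∖ π) c

  synth-yv : ∀ φ t → rsubT ⦅ φ ⦆ yv t ≡ ⦅ φ ⦆
  synth-yv tt t = refl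
  synth-yv ff t = refl
  synth-yv (⋀ bs) t = refl
  synth-yv (var X) t = refl
  synth-yv (max X φ) t = cong (rec (xv X)) (synth-yv φ t)

  data UnfoldedBranch (π : Pat) (c : Cond) : Form → Trans → Set where
    suppress : ∀ {e} → UnfoldedBranch π c ff (⟪ ipat π , c , oτ ⟫∙ e)
    forward  : ∀ {φ} → UnfoldedBranch π c φ (⟪ ipat π , c , opat (under π) ⟫∙ ⦅ φ ⦆)

  unfold-branch : ∀ π c φ t → UnfoldedBranch π c φ (rsubT (synB π c φ) yv t)
  unfold-branch π c tt t        = forward
  unfold-branch π c ff t        = suppress
  unfold-branch π c (⋀ _) t     = forward
  unfold-branch π c (var _) t   = forward
  unfold-branch π c (max X φ) t rewrite synth-yv φ t = forward

  summand-branch : ∀ bs {x t e} → e ∈ rsubTs (synBs bs) x t →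
                   Σ[ π ∈ Pat ] Σ[ c ∈ Cond ] Σ[ φ ∈ Form ]
                     (([ π , c ] φ) ∈ bs) × (e ≡ rsubT (synB π c φ) x t)
  summand-branch (([ π , c ] φ) ∷ bs) (here refl) = π , c , φ , here refl , refl
  summand-branch (([ π , c ] φ) ∷ bs) (there e∈) with summand-branch bs e∈
  ... | π' , c' , φ' , b∈bs , refl = π' , c' , φ' , there b∈bs , refl

  branch-summand : ∀ {bs x t π c φ} → ([ π , c ] φ) ∈ bs →
                   rsubT (synB π c φ) x t ∈ rsubTs (synBs bs) x t
  branch-summand {([ _ , _ ] _) ∷ bs} (here refl) = here refl
  branch-summand {([ _ , _ ] _) ∷ bs} (there b∈bs) = there (branch-summand b∈bs)

  -- A forwarding prefix triggered by α outputs α itself (the standing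
  -- assumption mtch-inst: instantiating π̲ by mtch(π,α) gives back α).
  forward-output : ∀ {π α σ} → mtch π α ≡ just σ → outI (opat (under π)) σ ≡ just ⟨ α ⟩
  forward-output {π} {α} {σ} m with toAct (substP σ (under π)) | mtch-inst π α σ m
  ... | just _ | refl = refl

  branch-no-bullet : ∀ {π c φ e μ e'} → UnfoldedBranch π c φ e → ¬ (e — in• ▷ μ ⟶ e')
  branch-no-bullet suppress (tPre () _ _)
  branch-no-bullet forward  (tPre () _ _)

  branch-fires : ∀ {π c φ e α σ} → UnfoldedBranch π c φ e → MtchS π c α σ →
                 Σ[ μ ∈ Actτ Act ] Σ[ e' ∈ Trans ] (e — inA α ▷ μ ⟶ e')
  branch-fires suppress (m , cσ) = τ , _ , tPre m cσ refl
  branch-fires forward  (m , cσ) = _ , _ , tPre m cσ (forward-output m)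

  branch-step : ∀ {π c φ e α' α e'} → UnfoldedBranch π c φ e → e — inA α' ▷ ⟨ α ⟩ ⟶ e' →
                Σ[ σ ∈ Sub ] MtchS π c α' σ × (α' ≡ α) × (e' ≡ ⦅ substF σ φ ⦆)
  branch-step suppress (tPre _ _ ())
  branch-step {φ = φ} forward (tPre {σ = σ} m cσ out)
    with just-injective (trans (sym (forward-output m)) out)
  ... | refl = σ , (m , cσ) , refl , synth-subst σ φ

  matching-unique : ∀ {bs} → AllPairs Disjoint bs → ∀ {π c φ π' c' φ' α σ σ'} →
                    ([ π , c ] φ) ∈ bs → ([ π' , c' ] φ') ∈ bs →
                    MtchS π c α σ → MtchS π' c' α σ' → ([ π , c ] φ) ≡ ([ π' , c' ] φ')
  matching-unique (_ ∷ _) (here refl) (here refl) _ _ = refl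
  matching-unique (d ∷ _) {α = α} {σ} {σ'} (here refl) (there b∈) m m' =
    ⊥-elim (All.lookup d b∈ α σ σ' m m')
  matching-unique (d ∷ _) {α = α} {σ} {σ'} (there b∈) (here refl) m m' =
    ⊥-elim (All.lookup d b∈ α σ' σ m' m)
  matching-unique (_ ∷ ds) (there b∈) (there b'∈) m m' = matching-unique ds b∈ b'∈ m m'

  -- A visible step of an unfolded disjoint conjunction ⋀ bs forwards its
  -- input, and its residual is ⦅after(⋀ bs, α)⦆: the branch that fired is
  -- the unique one matching α, which is the branch after selects.
  conj-step : ∀ {bs t e α' α e'} → AllPairs Disjoint bs → e ∈ rsubTs (synBs bs) yv t →
              e — inA α' ▷ ⟨ α ⟩ ⟶ e' →
              (α' ≡ α) × (∀ ψ → After (⋀ bs) ⟨ α ⟩ ψ → e' ≡ ⦅ ψ ⦆)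
  conj-step {bs} {t} {α = α} ds e∈ d with summand-branch bs e∈
  ... | π , c , φ , b∈bs , refl with branch-step (unfold-branch π c φ t) d
  ... | σ , match , refl , refl = refl , residual
    where
    residual : ∀ ψ → After (⋀ bs) ⟨ α ⟩ ψ → ⦅ substF σ φ ⦆ ≡ ⦅ ψ ⦆
    residual _ (aHit b'∈bs match') with matching-unique ds b∈bs b'∈bs match match'
    ... | refl = cong (λ σ' → ⦅ substF σ' φ ⦆)
                      (just-injective (trans (sym (proj₁ match)) (proj₁ match')))
    residual _ (aMiss none) = ⊥-elim (none b∈bs match)

  -- It is stated for any e equal to ⦅φ⦆ so that
  -- the induction on the derivation can pass through the unfolding of
  -- max X.φ, which is ⦅φ[max X.φ/X]⦆ only up to synth-rsub.
  synth-step : ∀ φ → AllDisjoint φ → ∀ {e α' α e'} → e ≡ ⦅ φ ⦆ → e — inA α' ▷ ⟨ α ⟩ ⟶ e' →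
               (α' ≡ α) × (∀ ψ → After φ ⟨ α ⟩ ψ → e' ≡ ⦅ ψ ⦆)
  synth-step tt _ refl tIdA = refl , λ { _ aTt → refl }
  synth-step ff _ refl tIdA = refl , λ { _ aFf → refl }
  synth-step (var X) _ refl ()
  synth-step (max X φ) (dMax dφ) refl (tRec d) =
    map₂ (λ residual ψ → λ { (aMax a) → residual ψ a })
         (synth-step (rsubF φ X (max X φ)) (AllDisjoint-rsub X dφ (dMax dφ))
                     (synth-rsub φ X (max X φ) (λ ())) d)
  synth-step (⋀ bs) (dAnd ds _) refl (tRec (tSum e∈ d)) = conj-step ds e∈ d

  synth-no-bullet : ∀ φ {e μ e'} → e ≡ ⦅ φ ⦆ → ¬ (e — in• ▷ μ ⟶ e')
  synth-no-bullet tt refl ()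
  synth-no-bullet ff refl ()
  synth-no-bullet (var X) refl ()
  synth-no-bullet (max X φ) refl (tRec d) =
    synth-no-bullet (rsubF φ X (max X φ)) (synth-rsub φ X (max X φ) (λ ())) d
  synth-no-bullet (⋀ bs) refl (tRec (tSum e∈ d)) with summand-branch bs e∈
  ... | π , c , φ , _ , refl = branch-no-bullet (unfold-branch π c φ _) d

  -- Rule (iTer): if ⦅φ⦆ cannot react to α, then no branch met while
  -- computing after(φ, α) matches α, so after(φ, α) ∈ {tt, ff}.
  synth-stuck : ∀ {φ α ψ} → After φ ⟨ α ⟩ ψ → (∀ {μ e'} → ¬ (⦅ φ ⦆ — inA α ▷ μ ⟶ e')) →
                id ≡ ⦅ ψ ⦆
  synth-stuck aTt _ = refl
  synth-stuck aFf _ = refl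
  synth-stuck {max X φ} (aMax a) stuck =
    synth-stuck a λ d → stuck (tRec (subst (λ e → e — _ ▷ _ ⟶ _)
                                            (sym (synth-rsub φ X (max X φ) (λ ()))) d))
  synth-stuck {⋀ bs} (aHit {π = π} {c} {φ} b∈bs match) stuck
    with branch-fires (unfold-branch π c φ (rec yv (sum (synBs bs)))) match
  ... | _ , _ , d = ⊥-elim (stuck (tRec (tSum (branch-summand b∈bs) d)))
  synth-stuck (aMiss _) _ = refl

open SynthesisProperties

mainTheorem8 : (S : Setting) (L : LTS (Setting.Act S)) →
    let open Setting S
        open LTS L
        open Theory S L
    in (p p' : Sys) (α : Act) (e' : Trans) (φ : Form) →
       NF φ → Closed φ →
       (⦅ φ ⦆ [ p ]) ⟹ ⟨ α ⟩ ⟹ (e' [ p' ]) →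
       (p — ⟨ α ⟩ ↦ p') × (∀ ψ → After φ ⟨ α ⟩ ψ → e' ≡ ⦅ ψ ⦆)
mainTheorem8 S L _ _ _ _ φ nf _ (Theory.iTrn p↦p' d)
  with synth-step S L φ (NF⇒AllDisjoint S L nf) refl d
... | refl , residual = p↦p' , residual
mainTheorem8 S L _ _ _ _ φ _ _ (Theory.iIns d) = ⊥-elim (synth-no-bullet S L φ refl d)
mainTheorem8 S L _ _ _ _ _ _ _ (Theory.iTer p↦p' stuck _) =
  p↦p' , λ ψ after → synth-stuck S L after stuck
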